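{- Let $f(X)=X^3+c_2X^2+c_1X+c_0\in\mathbb{Z}[X]$ be irreducible. Let $a_1,a_2\in\mathbb{Z}$, and let $q=q(a_1,a_2)$ be squarefree with smallest prime factor $P^-(q)>256$ and $(a_1a_2,q)=1$. Let $p\mid q$ be a prime with $p\nmid\mathrm{Disc}(f)$. Regard $U$ and $B_{13}$ (defined below) as polynomials in the variable $a_0$. Then there is no polynomial $l$ (of any degree) such that $$U\equiv B_{13}\,l\pmod p.$$
   Context: The polynomials are $$U=a_2^2,\qquad B_{13}=-a_2a_0+a_2^2c_1-a_1a_2c_2+a_1^2,$$ $$q(a_1,a_2)=a_2^3c_1c_2-a_1a_2^2c_2^2-a_2^3c_0-a_1a_2^2c_1+2a_1^2a_2c_2-a_1^3.$$ -}

module Defs where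

open import Data.Nat as ℕ using (ℕ; zero; suc)
open import Data.Integer as ℤ using (ℤ; +_; 0ℤ; 1ℤ; -1ℤ; _+_; _-_; _*_; -_; ∣_∣)
open import Data.Integer.GCD using (gcd)
open import Data.Integer.Divisibility using (_∣_)
open import Data.List using (List; []; _∷_; map)
open import Data.Product using (_×_; ∃)
open import Data.Sum using (_⊎_)
open import Relation.Nullary using (¬_)
open import Relation.Binary.PropositionalEquality using (_≡_)
open import Data.Nat.Primality using (Prime)

-- Polynomials in one variable over ℤ: coefficient lists, constant term first.
Poly : Set
Poly = List ℤ

coeff : Poly → ℕ → ℤ
coeff []       _       = 0ℤ
coeff (a ∷ _)  zero    = a
coeff (_ ∷ f)  (suc k) = coeff f k

infixl 6 _+ₚ_
infixl 7 _*ₚ_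

_+ₚ_ : Poly → Poly → Poly
[]      +ₚ g       = g
f       +ₚ []      = f
(a ∷ f) +ₚ (b ∷ g) = (a + b) ∷ (f +ₚ g)

_*ₚ_ : Poly → Poly → Poly
[]      *ₚ g = []
(a ∷ f) *ₚ g = map (a *_) g +ₚ (0ℤ ∷ (f *ₚ g))

-- Equality of polynomials (coefficientwise; insensitive to trailing zeros)
_≈ₚ_ : Poly → Poly → Set
f ≈ₚ g = ∀ k → coeff f k ≡ coeff g k

_≡ₚ_[mod_] : Poly → Poly → ℤ → Set
f ≡ₚ g [mod m ] = ∀ k → m ∣ (coeff f k - coeff g k)

IsUnitPoly : Poly → Set
IsUnitPoly g = (∀ k → coeff g (suc k) ≡ 0ℤ) × (coeff g 0 ≡ 1ℤ ⊎ coeff g 0 ≡ -1ℤ)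

Irreducible : Poly → Set
Irreducible f = ¬ (f ≈ₚ []) × ¬ IsUnitPoly f
  × (∀ g h → f ≈ₚ (g *ₚ h) → IsUnitPoly g ⊎ IsUnitPoly h)

cubic : ℤ → ℤ → ℤ → Poly
cubic c₂ c₁ c₀ = c₀ ∷ c₁ ∷ c₂ ∷ 1ℤ ∷ []

disc : ℤ → ℤ → ℤ → ℤ
disc c₂ c₁ c₀ = c₂ * c₂ * c₁ * c₁ - + 4 * c₁ * c₁ * c₁ - + 4 * c₂ * c₂ * c₂ * c₀
                - + 27 * c₀ * c₀ + + 18 * c₂ * c₁ * c₀

qpoly : ℤ → ℤ → ℤ → ℤ → ℤ → ℤ
qpoly c₂ c₁ c₀ a₁ a₂ =
  a₂ * a₂ * a₂ * c₁ * c₂ - a₁ * a₂ * a₂ * c₂ * c₂ - a₂ * a₂ * a₂ * c₀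
  - a₁ * a₂ * a₂ * c₁ + + 2 * a₁ * a₁ * a₂ * c₂ - a₁ * a₁ * a₁

Upoly : ℤ → Poly
Upoly a₂ = (a₂ * a₂) ∷ []

-- B13 = -a2 a0 + a2^2 c1 - a1 a2 c2 + a1^2, as a polynomial in a0
B13poly : ℤ → ℤ → ℤ → ℤ → Poly
B13poly c₂ c₁ a₁ a₂ = (a₂ * a₂ * c₁ - a₁ * a₂ * c₂ + a₁ * a₁) ∷ (- a₂) ∷ []

SquareFree : ℤ → Set
SquareFree q = ∀ d → (d * d) ∣ q → ∣ d ∣ ≡ 1

MinPrimeFactor> : ℕ → ℤ → Set
MinPrimeFactor> B q = ∀ r → Prime r → (+ r) ∣ q → B ℕ.< r

-- Modulo p the factor B₁₃ = b₀ - a₂ a₀ has leading coefficient -a₂, a unit because p ∤ a₂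
-- (as gcd(a₁a₂, q) = 1 and p ∣ q). Comparing coefficients of a₀^(k+1) in U ≡ B₁₃ l, where U is
-- constant, gives a₂ l_k ≡ b₀ l_(k+1), so by descending induction from the top every coefficient
-- of l vanishes mod p. The constant terms then give a₂² ≡ b₀ l₀ ≡ 0, contradicting p ∤ a₂.
module Submission where

open import Defs
open import Data.Nat using (ℕ)
open import Data.Integer using (ℤ; +_; _*_; 1ℤ)
open import Data.Integer.GCD using (gcd)
open import Data.Integer.Divisibility using (_∣_)
open import Data.Nat.Primality using (Prime)
open import Data.Product using (∃)
open import Relation.Nullary using (¬_)
open import Relation.Binary.PropositionalEquality using (_≡_)

open import Data.Nat as ℕ using (zero; suc; _≤_; s≤s)
open import Data.Nat.Properties using (+-suc; m≤m+n)
import Data.Nat.Divisibility as ℕ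
open import Data.Nat.Primality using (euclidsLemma; ¬prime[1])
open import Data.Integer using (0ℤ; _+_; _-_; -_; ∣_∣)
open import Data.Integer.Properties using (+-identityˡ; +-identityʳ; *-zeroʳ; abs-*; neg-involutive)
open import Data.Integer.Divisibility.Signed as Signed
  using (∣ᵤ⇒∣; ∣⇒∣ᵤ; ∣m⇒∣-m; ∣m+n∣m⇒∣n; ∣m+n∣n⇒∣m; ∣n⇒∣m*n)
open import Data.Integer.GCD using (gcd-greatest)
open import Data.List using ([]; _∷_; map; length)
open import Data.Product using (_,_)
open import Data.Sum using (_⊎_; inj₁; inj₂; [_,_]′)
open import Relation.Nullary using (contradiction)
open import Function using (id)
open import Relation.Binary.PropositionalEquality using (refl; sym; subst; cong₂; module ≡-Reasoning)
open ≡-Reasoning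

coeff-+ₚ : ∀ f g k → coeff (f +ₚ g) k ≡ coeff f k + coeff g k
coeff-+ₚ []      g       k       = sym (+-identityˡ (coeff g k))
coeff-+ₚ (a ∷ f) []      k       = sym (+-identityʳ (coeff (a ∷ f) k))
coeff-+ₚ (a ∷ f) (b ∷ g) zero    = refl
coeff-+ₚ (a ∷ f) (b ∷ g) (suc k) = coeff-+ₚ f g k

coeff-map-* : ∀ a g k → coeff (map (a *_) g) k ≡ a * coeff g k
coeff-map-* a []      k       = sym (*-zeroʳ a)
coeff-map-* a (b ∷ g) zero    = refl
coeff-map-* a (b ∷ g) (suc k) = coeff-map-* a g k

coeff-≥length : ∀ f {k} → length f ≤ k → coeff f k ≡ 0ℤ
coeff-≥length []      _         = refl
coeff-≥length (a ∷ f) (s≤s len) = coeff-≥length f len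

coeff-linear*ₚ-zero : ∀ b₀ b₁ l → coeff ((b₀ ∷ b₁ ∷ []) *ₚ l) 0 ≡ b₀ * coeff l 0
coeff-linear*ₚ-zero b₀ b₁ l = begin
  coeff (map (b₀ *_) l +ₚ (0ℤ ∷ ((b₁ ∷ []) *ₚ l))) 0
    ≡⟨ coeff-+ₚ (map (b₀ *_) l) (0ℤ ∷ ((b₁ ∷ []) *ₚ l)) 0 ⟩
  coeff (map (b₀ *_) l) 0 + 0ℤ
    ≡⟨ +-identityʳ _ ⟩
  coeff (map (b₀ *_) l) 0
    ≡⟨ coeff-map-* b₀ l 0 ⟩
  b₀ * coeff l 0 ∎

coeff-linear*ₚ-suc : ∀ b₀ b₁ l k →
  coeff ((b₀ ∷ b₁ ∷ []) *ₚ l) (suc k) ≡ b₀ * coeff l (suc k) + b₁ * coeff l k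
coeff-linear*ₚ-suc b₀ b₁ l k = begin
  coeff (map (b₀ *_) l +ₚ (0ℤ ∷ ((b₁ ∷ []) *ₚ l))) (suc k)
    ≡⟨ coeff-+ₚ (map (b₀ *_) l) (0ℤ ∷ ((b₁ ∷ []) *ₚ l)) (suc k) ⟩
  coeff (map (b₀ *_) l) (suc k) + coeff (map (b₁ *_) l +ₚ (0ℤ ∷ [])) k
    ≡⟨ cong₂ _+_ (coeff-map-* b₀ l (suc k)) b₁l ⟩
  b₀ * coeff l (suc k) + b₁ * coeff l k ∎
  where
  zero-coeff : ∀ j → coeff (0ℤ ∷ []) j ≡ 0ℤ
  zero-coeff zero    = refl
  zero-coeff (suc j) = refl

  b₁l : coeff (map (b₁ *_) l +ₚ (0ℤ ∷ [])) k ≡ b₁ * coeff l k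
  b₁l = begin
    coeff (map (b₁ *_) l +ₚ (0ℤ ∷ [])) k    ≡⟨ coeff-+ₚ (map (b₁ *_) l) (0ℤ ∷ []) k ⟩
    coeff (map (b₁ *_) l) k + coeff (0ℤ ∷ []) k ≡⟨ cong₂ _+_ (coeff-map-* b₁ l k) (zero-coeff k) ⟩
    b₁ * coeff l k + 0ℤ                         ≡⟨ +-identityʳ _ ⟩
    b₁ * coeff l k ∎

∣-m⇒∣m : ∀ {i m} → i Signed.∣ - m → i Signed.∣ m
∣-m⇒∣m {m = m} i∣-m = subst (_ Signed.∣_) (neg-involutive m) (∣m⇒∣-m i∣-m)

∣m-n∣m⇒∣n : ∀ {i m n} → i Signed.∣ m - n → i Signed.∣ m → i Signed.∣ n
∣m-n∣m⇒∣n i∣m-n i∣m = ∣-m⇒∣m (∣m+n∣m⇒∣n i∣m-n i∣m)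

∣m-n∣n⇒∣m : ∀ {i m n} → i Signed.∣ m - n → i Signed.∣ n → i Signed.∣ m
∣m-n∣n⇒∣m i∣m-n i∣n = ∣m+n∣n⇒∣m i∣m-n (∣m⇒∣-m i∣n)

module _ {p : ℕ} (p-prime : Prime p) where

  prime∣m*n⇒∣m⊎∣n : ∀ m n → + p Signed.∣ m * n → + p Signed.∣ m ⊎ + p Signed.∣ n
  prime∣m*n⇒∣m⊎∣n m n p∣mn with euclidsLemma ∣ m ∣ ∣ n ∣ p-prime (subst (p ℕ.∣_) (abs-* m n) (∣⇒∣ᵤ p∣mn))
  ... | inj₁ p∣m = inj₁ (∣ᵤ⇒∣ p∣m)
  ... | inj₂ p∣n = inj₂ (∣ᵤ⇒∣ p∣n)

  prime∤1 : ¬ (+ p ∣ 1ℤ)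
  prime∤1 p∣1 = ¬prime[1] (subst Prime (ℕ.∣1⇒≡1 p∣1) p-prime)

  linear*ₚ-highCoeffs-∣⇒∣coeffs : ∀ b₀ b₁ l → ¬ (+ p Signed.∣ b₁) →
    (∀ k → + p Signed.∣ coeff ((b₀ ∷ b₁ ∷ []) *ₚ l) (suc k)) →
    ∀ k → + p Signed.∣ coeff l k
  linear*ₚ-highCoeffs-∣⇒∣coeffs b₀ b₁ l p∤b₁ p∣high k = descend (length l) k (m≤m+n (length l) k)
    where
    step : ∀ k → + p Signed.∣ coeff l (suc k) → + p Signed.∣ coeff l k
    step k p∣lₖ₊₁ with prime∣m*n⇒∣m⊎∣n b₁ (coeff l k) p∣b₁lₖ
      where
      p∣b₁lₖ : + p Signed.∣ b₁ * coeff l k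
      p∣b₁lₖ = ∣m+n∣m⇒∣n (subst (_ Signed.∣_) (coeff-linear*ₚ-suc b₀ b₁ l k) (p∣high k))
                         (∣n⇒∣m*n b₀ p∣lₖ₊₁)
    ... | inj₁ p∣b₁ = contradiction p∣b₁ p∤b₁
    ... | inj₂ p∣lₖ = p∣lₖ

    descend : ∀ m k → length l ≤ m ℕ.+ k → + p Signed.∣ coeff l k
    descend zero    k len = subst (_ Signed.∣_) (sym (coeff-≥length l len)) (∣ᵤ⇒∣ (p ℕ.∣0))
    descend (suc m) k len = step k (descend m (suc k) (subst (length l ≤_) (sym (+-suc m k)) len))

lemma12 : (c₂ c₁ c₀ a₁ a₂ : ℤ) → Irreducible (cubic c₂ c₁ c₀)
    → SquareFree (qpoly c₂ c₁ c₀ a₁ a₂) → MinPrimeFactor> 256 (qpoly c₂ c₁ c₀ a₁ a₂)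
    → gcd (a₁ * a₂) (qpoly c₂ c₁ c₀ a₁ a₂) ≡ 1ℤ
    → (p : ℕ) → Prime p → (+ p) ∣ qpoly c₂ c₁ c₀ a₁ a₂ → ¬ ((+ p) ∣ disc c₂ c₁ c₀)
    → ¬ (∃ λ (l : Poly) → Upoly a₂ ≡ₚ B13poly c₂ c₁ a₁ a₂ *ₚ l [mod + p ])
lemma12 c₂ c₁ c₀ a₁ a₂ _ _ _ gcd≡1 p p-prime p∣q _ (l , U≡B₁₃l) = p∤a₂ p∣a₂
  where
  b₀ : ℤ
  b₀ = a₂ * a₂ * c₁ - a₁ * a₂ * c₂ + a₁ * a₁
  B₁₃l : Poly
  B₁₃l = B13poly c₂ c₁ a₁ a₂ *ₚ l

  p∤a₂ : ¬ (+ p Signed.∣ a₂)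
  p∤a₂ p∣a₂ = prime∤1 p-prime
    (subst (+ p ∣_) gcd≡1
      (gcd-greatest {a₁ * a₂} {qpoly c₂ c₁ c₀ a₁ a₂} {+ p} (∣⇒∣ᵤ (∣n⇒∣m*n a₁ p∣a₂)) p∣q))

  p∣U-B₁₃l : ∀ k → + p Signed.∣ coeff (Upoly a₂) k - coeff B₁₃l k
  p∣U-B₁₃l k = ∣ᵤ⇒∣ (U≡B₁₃l k)

  p∣l : ∀ k → + p Signed.∣ coeff l k
  p∣l = linear*ₚ-highCoeffs-∣⇒∣coeffs p-prime b₀ (- a₂) l (λ p∣-a₂ → p∤a₂ (∣-m⇒∣m p∣-a₂))
          (λ k → ∣m-n∣m⇒∣n {m = 0ℤ} (p∣U-B₁₃l (suc k)) (∣ᵤ⇒∣ (p ℕ.∣0)))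

  p∣a₂² : + p Signed.∣ a₂ * a₂
  p∣a₂² = ∣m-n∣n⇒∣m (p∣U-B₁₃l 0)
    (subst (_ Signed.∣_) (sym (coeff-linear*ₚ-zero b₀ (- a₂) l)) (∣n⇒∣m*n b₀ (p∣l 0)))

  p∣a₂ : + p Signed.∣ a₂
  p∣a₂ = [ id , id ]′ (prime∣m*n⇒∣m⊎∣n p-prime a₂ a₂ p∣a₂²)
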